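{- Let $\Omega$ be a ranked signature with a non-empty set $\Omega_0$ of constants, let $\mathcal{T}_\Omega$ be the set of ground terms over $\Omega$, and let $\mathbf{X}$ be a finite set of program variables. 1. For a ground term $s\in\mathcal{T}_\Omega$, the single equality $A s \doteq C$ has exactly one solution in which $A=\bullet$ (namely $C=s$). 2. Let $s_1\neq s_2$ be terms over $\Omega$ that both contain occurrences of the same program variable $\mathbf{x}$ (and no other program variable). If the conjunction $A s_1 \doteq C \wedge A s_2 \doteq C$ is satisfiable, then the value of $\mathbf{x}$ in any satisfying variable assignment is uniquely determined.
   Context: $\bullet$ is a fresh dedicated variable. A template is a term over $\Omega\cup\{\bullet\}$ containing at least one occurrence of $\bullet$. For a template $r$ and a term $u$, the juxtaposition $ru$ denotes $r[u/\bullet]$, the result of substituting $u$ for all occurrences of $\bullet$ in $r$. $A$ is a template variable (ranging over templates) and $C$ is a ground template variable (ranging over ground terms). A variable assignment $\sigma$ maps each program variable and $C$ to a ground term and $A$ to a template; it is extended homomorphically to terms (identity on symbols of $\Omega$), with $\sigma(At)=\sigma(A)\,\sigma(t)$. $\sigma$ satisfies $e_1\doteq e_2$ iff $\sigma(e_1)=\sigma(e_2)$, and satisfies a conjunction iff it satisfies every conjunct; a conjunction is satisfiable if some variable assignment satisfies it. A solution of an equality without program variables is an assignment of values to its template variables satisfying it. -}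

module Defs where

open import Data.Nat using (ℕ)
open import Data.Fin using (Fin)
open import Data.Vec using (Vec; []; _∷_; lookup)
open import Data.Empty using (⊥)
open import Data.Unit using (⊤; tt)
open import Data.Product using (Σ; _×_; ∃)
open import Relation.Binary.PropositionalEquality using (_≡_)

record Signature : Set₁ where
  field
    Sym   : Set
    arity : Sym → ℕ
open Signature public

HasConstant : Signature → Set
HasConstant Ω = Σ (Sym Ω) λ f → arity Ω f ≡ 0

module _ (Ω : Signature) where

  data Term (V : Set) : Set where
    var  : V → Term V
    node : (f : Sym Ω) → Vec (Term V) (arity Ω f) → Term V

  data _occursIn_ {V : Set} (v : V) : Term V → Set where
    here  : v occursIn var v
    there : ∀ {f ts} (i : Fin (arity Ω f)) → v occursIn lookup ts i → v occursIn node f ts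

  mutual
    subst : {V W : Set} → (V → Term W) → Term V → Term W
    subst σ (var v)     = σ v
    subst σ (node f ts) = node f (substs σ ts)

    substs : {V W : Set} {k : ℕ} → (V → Term W) → Vec (Term V) k → Vec (Term W) k
    substs σ []       = []
    substs σ (t ∷ ts) = subst σ t ∷ substs σ ts

  Ground : Set
  Ground = Term ⊥

  -- The hole ● is the unique variable of Term ⊤.
  ● : Term ⊤
  ● = var tt

  record Template : Set where
    constructor template
    field
      body   : Term ⊤
      hasHole : tt occursIn body
  open Template public

  plug : {W : Set} → Term ⊤ → Term W → Term W
  plug r u = subst (λ _ → u) r

  record Assignment (n : ℕ) : Set where
    field
      prog : Fin n → Ground
      valC : Ground
      valA : Template
  open Assignment public

  SatAsC : {n : ℕ} → Assignment n → Term (Fin n) → Set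
  SatAsC σ s = plug (body (valA σ)) (subst (prog σ) s) ≡ valC σ

  Sat2 : {n : ℕ} → Assignment n → Term (Fin n) → Term (Fin n) → Set
  Sat2 σ s₁ s₂ = SatAsC σ s₁ × SatAsC σ s₂

  Solution : Ground → Template → Ground → Set
  Solution s A C = plug (body A) s ≡ C

module Submission where

-- Part 1 is immediate: plugging s into the trivial template ● gives s back.
--
-- Part 2 is a uniqueness result for one-variable unification.  A template r
-- contains the hole, so plugging into it is injective; hence any assignment
-- satisfying  A s₁ ≐ C ∧ A s₂ ≐ C  is, on the program variables, a unifier
-- of s₁ and s₂.
-- From the occurs check, an equation  x ≐ t  with t a non-variable term in
-- the variable x alone forces t to be closed, so every unifier gives x the
-- same value.  Simultaneous induction on s₁ and s₂ then shows that two
-- unifiers σ, τ of terms in the single variable x either witness s₁ ≡ s₂ or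
-- agree on x, which, with s₁ ≢ s₂, is Part 2.

open import Defs
open import Data.Nat using (ℕ; suc; _+_; _≤_; _<_; s≤s)
open import Data.Nat.Properties using (≤-refl; ≤-trans; m≤m+n; m≤n+m; <-irrefl; m≤n⇒m≤1+n)
open import Data.Fin using (Fin; zero; suc)
open import Data.Vec using (Vec; []; _∷_; lookup)
open import Data.Vec.Properties using (∷-injective)
open import Data.Product using (_×_; ∃; _,_; proj₁; proj₂)
open import Data.Sum using (_⊎_; inj₁; inj₂)
open import Data.Empty using (⊥; ⊥-elim)
open import Data.Unit using (⊤; tt)
open import Relation.Binary.PropositionalEquality
  using (_≡_; refl; sym; trans; cong; cong₂; module ≡-Reasoning)
  renaming (subst to transport)
open import Relation.Nullary using (¬_)

module Unification (Ω : Signature) where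

  node-injˡ : ∀ {W} {f g a b} → node {Ω} {W} f a ≡ node g b → f ≡ g
  node-injˡ refl = refl

  node-injʳ : ∀ {W} {f a b} → node {Ω} {W} f a ≡ node f b → a ≡ b
  node-injʳ refl = refl

  lookup-substs : ∀ {V W k} (σ : V → Term Ω W) (ts : Vec (Term Ω V) k) (i : Fin k)
    → lookup (substs Ω σ ts) i ≡ subst Ω σ (lookup ts i)
  lookup-substs σ (t ∷ ts) zero    = refl
  lookup-substs σ (t ∷ ts) (suc i) = lookup-substs σ ts i

  -- Plugging into a term r that contains the hole is injective: follow the
  -- path to an occurrence of ● in both sides.
  plug-injective : ∀ {W} (r : Term Ω ⊤) {u v : Term Ω W} → _occursIn_ Ω tt r
    → plug Ω r u ≡ plug Ω r v → u ≡ v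
  plug-injective .(var tt)   here        e = e
  plug-injective (node f ts) {u} {v} (there i o) e = plug-injective (lookup ts i) o (begin
      plug Ω (lookup ts i) u             ≡⟨ sym (lookup-substs (λ _ → u) ts i) ⟩
      lookup (substs Ω (λ _ → u) ts) i   ≡⟨ cong (λ us → lookup us i) (node-injʳ e) ⟩
      lookup (substs Ω (λ _ → v) ts) i   ≡⟨ lookup-substs (λ _ → v) ts i ⟩
      plug Ω (lookup ts i) v             ∎)
    where open ≡-Reasoning

  mutual
    size : ∀ {W} → Term Ω W → ℕ
    size (var _)     = 1
    size (node f ts) = suc (sizes ts)

    sizes : ∀ {W k} → Vec (Term Ω W) k → ℕ
    sizes []       = 0
    sizes (t ∷ ts) = size t + sizes ts

  lookup-size : ∀ {W k} (ts : Vec (Term Ω W) k) (i : Fin k) → size (lookup ts i) ≤ sizes ts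
  lookup-size (t ∷ ts) zero    = m≤m+n _ _
  lookup-size (t ∷ ts) (suc i) = ≤-trans (lookup-size ts i) (m≤n+m _ _)

  mutual
    occurs-size : ∀ {V W} (σ : V → Term Ω W) {x : V} (t : Term Ω V)
      → _occursIn_ Ω x t → size (σ x) ≤ size (subst Ω σ t)
    occurs-size σ .(var _)   here        = ≤-refl
    occurs-size σ (node f ts) (there i o) = m≤n⇒m≤1+n (occurs-sizes σ ts i o)

    occurs-sizes : ∀ {V W k} (σ : V → Term Ω W) {x : V} (ts : Vec (Term Ω V) k) (i : Fin k)
      → _occursIn_ Ω x (lookup ts i) → size (σ x) ≤ sizes (substs Ω σ ts)
    occurs-sizes σ ts i o = ≤-trans (occurs-size σ (lookup ts i) o)
      (transport (λ t → size t ≤ sizes (substs Ω σ ts)) (lookup-substs σ ts i)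
        (lookup-size (substs Ω σ ts) i))

  occurs-check : ∀ {V W} (σ : V → Term Ω W) {x : V} f ts
    → _occursIn_ Ω x (node f ts) → ¬ (σ x ≡ subst Ω σ (node f ts))
  occurs-check σ f ts (there i o) e = <-irrefl (cong size e) (s≤s (occurs-sizes σ ts i o))

  Closed : ∀ {V} → Term Ω V → Set
  Closed t = ∀ y → _occursIn_ Ω y t → ⊥

  mutual
    subst-closed : ∀ {V W} (σ τ : V → Term Ω W) (t : Term Ω V)
      → Closed t → subst Ω σ t ≡ subst Ω τ t
    subst-closed σ τ (var y)     c = ⊥-elim (c y here)
    subst-closed σ τ (node f ts) c = cong (node f) (substs-closed σ τ ts (λ i y o → c y (there i o)))

    substs-closed : ∀ {V W k} (σ τ : V → Term Ω W) (ts : Vec (Term Ω V) k)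
      → (∀ i → Closed (lookup ts i)) → substs Ω σ ts ≡ substs Ω τ ts
    substs-closed σ τ []       c = refl
    substs-closed σ τ (t ∷ ts) c =
      cong₂ _∷_ (subst-closed σ τ t (c zero)) (substs-closed σ τ ts (λ i → c (suc i)))

  OnlyVar : ∀ {V} → V → Term Ω V → Set
  OnlyVar x t = ∀ y → _occursIn_ Ω y t → y ≡ x

  -- A solvable equation x ≐ node f ts, with x the only variable, determines x:
  -- by the occurs check the node is closed, so both solutions equal it.
  solved-form-unique : ∀ {V W} (σ τ : V → Term Ω W) (x : V) f ts
    → OnlyVar x (node f ts)
    → σ x ≡ subst Ω σ (node f ts) → τ x ≡ subst Ω τ (node f ts) → σ x ≡ τ x
  solved-form-unique σ τ x f ts only eσ eτ =
    trans eσ (trans (subst-closed σ τ (node f ts) closed) (sym eτ))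
    where
    closed : Closed (node f ts)
    closed y o with only y o
    ... | refl = occurs-check σ f ts o eσ

  -- Induction on both terms; the var/node cases are
  -- solved forms, the node/node case decomposes into the arguments.
  mutual
    unifiers-agree : ∀ {V W} (σ τ : V → Term Ω W) (x : V) (s₁ s₂ : Term Ω V)
      → OnlyVar x s₁ → OnlyVar x s₂
      → subst Ω σ s₁ ≡ subst Ω σ s₂ → subst Ω τ s₁ ≡ subst Ω τ s₂
      → s₁ ≡ s₂ ⊎ σ x ≡ τ x
    unifiers-agree σ τ x (var y) (var z) o₁ o₂ eσ eτ =
      inj₁ (cong var (trans (o₁ y here) (sym (o₂ z here))))
    unifiers-agree σ τ x (var y) (node g us) o₁ o₂ eσ eτ with o₁ y here
    ... | refl = inj₂ (solved-form-unique σ τ y g us o₂ eσ eτ)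
    unifiers-agree σ τ x (node f ts) (var z) o₁ o₂ eσ eτ with o₂ z here
    ... | refl = inj₂ (solved-form-unique σ τ z f ts o₁ (sym eσ) (sym eτ))
    unifiers-agree σ τ x (node f ts) (node g us) o₁ o₂ eσ eτ with node-injˡ eσ
    ... | refl with unifiers-agree* σ τ x ts us
                      (λ i y o → o₁ y (there i o)) (λ i y o → o₂ y (there i o))
                      (node-injʳ eσ) (node-injʳ eτ)
    ... | inj₁ e = inj₁ (cong (node f) e)
    ... | inj₂ e = inj₂ e

    unifiers-agree* : ∀ {V W k} (σ τ : V → Term Ω W) (x : V) (ts us : Vec (Term Ω V) k)
      → (∀ i → OnlyVar x (lookup ts i)) → (∀ i → OnlyVar x (lookup us i))
      → substs Ω σ ts ≡ substs Ω σ us → substs Ω τ ts ≡ substs Ω τ us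
      → ts ≡ us ⊎ σ x ≡ τ x
    unifiers-agree* σ τ x [] [] o₁ o₂ eσ eτ = inj₁ refl
    unifiers-agree* σ τ x (t ∷ ts) (u ∷ us) o₁ o₂ eσ eτ
      with unifiers-agree σ τ x t u (o₁ zero) (o₂ zero)
             (proj₁ (∷-injective eσ)) (proj₁ (∷-injective eτ))
    ... | inj₂ e = inj₂ e
    ... | inj₁ e with unifiers-agree* σ τ x ts us (λ i → o₁ (suc i)) (λ i → o₂ (suc i))
                        (proj₂ (∷-injective eσ)) (proj₂ (∷-injective eτ))
    ... | inj₁ e' = inj₁ (cong₂ _∷_ e e')
    ... | inj₂ e' = inj₂ e'

open Unification

sat2-unifies : (Ω : Signature) {n : ℕ} (σ : Assignment Ω n) (s₁ s₂ : Term Ω (Fin n))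
  → Sat2 Ω σ s₁ s₂ → subst Ω (prog σ) s₁ ≡ subst Ω (prog σ) s₂
sat2-unifies Ω σ s₁ s₂ (e₁ , e₂) =
  plug-injective Ω (body (valA σ)) (hasHole (valA σ)) (trans e₁ (sym e₂))

theorem1 : (Ω : Signature) → HasConstant Ω → (n : ℕ)
    → ((s : Ground Ω)
        → Solution Ω s (template (● Ω) (here)) s
          × ((A : Template Ω) (C : Ground Ω) → body A ≡ ● Ω → Solution Ω s A C → C ≡ s))
    × ((s₁ s₂ : Term Ω (Fin n)) (x : Fin n)
        → ¬ (s₁ ≡ s₂)
        → _occursIn_ Ω x s₁ → _occursIn_ Ω x s₂
        → ((y : Fin n) → _occursIn_ Ω y s₁ → y ≡ x)
        → ((y : Fin n) → _occursIn_ Ω y s₂ → y ≡ x)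
        → (∃ λ (σ : Assignment Ω n) → Sat2 Ω σ s₁ s₂)
        → (σ τ : Assignment Ω n) → Sat2 Ω σ s₁ s₂ → Sat2 Ω τ s₁ s₂
        → prog σ x ≡ prog τ x)
theorem1 Ω _ n = hole-solution , unique-value
  where
  hole-solution : (s : Ground Ω)
    → Solution Ω s (template (● Ω) here) s
      × ((A : Template Ω) (C : Ground Ω) → body A ≡ ● Ω → Solution Ω s A C → C ≡ s)
  hole-solution s = refl , λ { (template .(var tt) _) C refl e → sym e }

  -- Both assignments unify s₁ ≢ s₂, so they agree on x.
  unique-value : (s₁ s₂ : Term Ω (Fin n)) (x : Fin n) → ¬ (s₁ ≡ s₂)
    → _occursIn_ Ω x s₁ → _occursIn_ Ω x s₂
    → OnlyVar Ω x s₁ → OnlyVar Ω x s₂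
    → (∃ λ (σ : Assignment Ω n) → Sat2 Ω σ s₁ s₂)
    → (σ τ : Assignment Ω n) → Sat2 Ω σ s₁ s₂ → Sat2 Ω τ s₁ s₂
    → prog σ x ≡ prog τ x
  unique-value s₁ s₂ x s₁≢s₂ _ _ only₁ only₂ _ σ τ satσ satτ
    with unifiers-agree Ω (prog σ) (prog τ) x s₁ s₂ only₁ only₂
           (sat2-unifies Ω σ s₁ s₂ satσ) (sat2-unifies Ω τ s₁ s₂ satτ)
  ... | inj₁ s₁≡s₂ = ⊥-elim (s₁≢s₂ s₁≡s₂)
  ... | inj₂ agree = agree
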